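{- For every integer $k\geq 7$, the lower density threshold of $k$-Visits is at most $5/6+1/\lfloor (k-1)/6\rfloor$; that is, there exist instances $D$ with density arbitrarily close to (from above) or at most $5/6+1/\lfloor (k-1)/6\rfloor$ that admit no $k$-Visits schedule, so no $\delta>5/6+1/\lfloor (k-1)/6\rfloor$ has the property that all instances of density at most $\delta$ admit a $k$-Visits schedule.
   Context: $k$-Visits: given a multiset of positive integers (deadlines) $D=\{d_1,\ldots,d_n\}$, decide whether there is a sequence of length $nk$ with entries in $[n]$, containing each $i$ exactly $k$ times, such that the first occurrence of $i$ is within the first $d_i$ positions and every later occurrence of $i$ is at most $d_i$ positions after the previous one. The density of $D$ is $\mathrm{Dens}(D)=\sum_i 1/d_i$. The lower density threshold of $k$-Visits is the largest value $\delta$ such that every instance with density at most $\delta$ admits a $k$-Visits schedule.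
   Formalization: The value δ exceeding 5/6+1/⌊(k−1)/6⌋ ranges over the rationals. -}

module Defs where

open import Data.Nat using (ℕ; zero; suc; _+_; _*_; _∸_; _<_; _≤_)
open import Data.Nat.DivMod using (_/_)
open import Data.Integer using (+_)
open import Data.Rational as ℚ using (ℚ)
open import Data.Fin using (Fin; toℕ) renaming (_≟_ to _≟ᶠ_)
open import Data.List using (List; length; foldr; lookup)
open import Data.Vec as Vec using (Vec)
open import Data.Product using (Σ; ∃; _×_)
open import Data.Sum using (_⊎_)
open import Relation.Binary.PropositionalEquality using (_≡_)

-- 1/d as a rational; only used for d ≥ 1 (deadlines are positive); 1/0 := 0 by convention.
inv : ℕ → ℚ
inv zero    = ℚ.0ℚ
inv (suc d) = (+ 1) ℚ./ suc d

-- Dens(D) = Σ_i 1/d_i ; an instance (multiset) is represented by a list.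
density : List ℕ → ℚ
density = foldr (λ d acc → inv d ℚ.+ acc) ℚ.0ℚ

bound : ℕ → ℚ
bound k = ((+ 5) ℚ./ 6) ℚ.+ inv ((k ∸ 1) / 6)

-- job i occurs at (1-indexed) position q of the sequence s
OccAt : ∀ {n m} → Vec (Fin n) m → Fin n → ℕ → Set
OccAt {m = m} s i q = Σ (Fin m) (λ q' → (suc (toℕ q') ≡ q) × (Vec.lookup s q' ≡ i))

-- A k-Visits schedule for D (n = |D|): a sequence of length n*k over [n],
-- each i occurring exactly k times; the first occurrence of i is within
-- the first d_i positions, and each later occurrence is at most d_i
-- positions after the previous one.  Position 0 is a virtual start:
-- for p = 0 or p an occurrence of i, if some occurrence of i lies after p
-- then the next one lies in (p, p + d_i].
record Schedule (D : List ℕ) (k : ℕ) : Set where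
  field
    seq   : Vec (Fin (length D)) (length D * k)
    count : ∀ (i : Fin (length D)) → Vec.count (_≟ᶠ i) seq ≡ k
    gaps  : ∀ (i : Fin (length D)) (p : ℕ) →
            (p ≡ 0 ⊎ OccAt seq i p) →
            (∃ λ q → p < q × OccAt seq i q) →
            ∃ λ q → p < q × q ≤ p + lookup D i × OccAt seq i q

{-# OPTIONS --safe #-}
module Submission where

-- The instance is {2, 3, m} with m = ⌊(k-1)/6⌋, of density exactly 5/6 + 1/m.
-- The jobs of deadlines 2 and 3 leave no room for a third job at any position
-- t ∈ [2, k], where neither of them can have finished its k visits: the job of
-- deadline 2 would have to occupy t - 1 and t + 1, and the job of deadline 3
-- would then have to skip from t - 2 or earlier to t + 2 or later.  Yet the job
-- of deadline m < k visits within m positions of the start, and again within m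
-- positions of that, so one of these first two visits lies in [2, k].

open import Defs
open import Data.Nat using (ℕ; zero; suc; _+_; _∸_; _<_; _≤_; _≟_; z≤n; s≤s; s≤s⁻¹)
open import Data.Nat.Properties
  using (≤-refl; ≤-trans; ≤-antisym; <-trans; ≤-<-trans; <⇒≱; m≤n⇒m≤1+n; <-cmp; suc-injective; m<n⇒m<1+n;
         m≤n⇒m<n∨m≡n; +-comm; +-monoʳ-≤; ∸-monoˡ-≤; ∸-monoʳ-<)
open import Data.Nat.DivMod using (_/_; m/n≤m; m≥n⇒m/n>0)
open import Data.Fin using (Fin; toℕ) renaming (_≟_ to _≟ᶠ_; zero to fzero; suc to fsuc)
open import Data.Fin.Properties using (toℕ-injective; any?)
open import Data.Vec as Vec using (Vec; _∷_)
open import Data.List using (List; length; lookup; _∷_; [])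
open import Data.List.Relation.Unary.All using (All; _∷_; [])
open import Data.Product using (∃; ∃₂; _×_; _,_)
open import Data.Sum using (_⊎_; inj₁; inj₂)
open import Data.Empty using (⊥-elim)
open import Data.Rational using (ℚ) renaming (_<_ to _<ℚ_; _≤_ to _≤ℚ_)
import Data.Rational as ℚ
import Data.Rational.Properties as ℚ
open import Relation.Binary using (tri<; tri≈; tri>)
open import Relation.Binary.PropositionalEquality using (_≡_; _≢_; refl; sym; trans; cong; subst)
open import Relation.Nullary using (¬_; yes; no; _×-dec_)
open import Relation.Unary using (Decidable)

OccAt-unique : ∀ {n m} (s : Vec (Fin n) m) {i j q} → OccAt s i q → OccAt s j q → i ≡ j
OccAt-unique s (q₁ , refl , sq₁≡i) (q₂ , e , sq₂≡j) =
  trans (sym sq₁≡i) (trans (cong (Vec.lookup s) (toℕ-injective (suc-injective (sym e)))) sq₂≡j)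

OccAt-∷ : ∀ {n m} {s : Vec (Fin n) m} {i q} x → OccAt s i q → OccAt (x ∷ s) i (suc q)
OccAt-∷ x (q′ , refl , sq′≡i) = fsuc q′ , refl , sq′≡i

OccAt? : ∀ {n m} (s : Vec (Fin n) m) (i : Fin n) → Decidable (OccAt s i)
OccAt? s i q = any? λ q′ → (suc (toℕ q′) ≟ q) ×-dec (Vec.lookup s q′ ≟ᶠ i)

occurs-after : ∀ {n m} (s : Vec (Fin n) m) (i : Fin n) {t} →
  t < Vec.count (_≟ᶠ i) s → ∃ λ q → t < q × OccAt s i q
occurs-after (x ∷ s) i t<count with x ≟ᶠ i
occurs-after (x ∷ s) i {zero}  _            | yes x≡i = 1 , s≤s z≤n , fzero , refl , x≡i
occurs-after (x ∷ s) i {suc t} (s≤s t<count) | yes _ =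
  let q , t<q , occ = occurs-after s i t<count in suc q , s≤s t<q , OccAt-∷ x occ
occurs-after (x ∷ s) i t<count | no _ =
  let q , t<q , occ = occurs-after s i t<count in suc q , m<n⇒m<1+n t<q , OccAt-∷ x occ

module _ {O : ℕ → Set} (O? : Decidable O) where

  latest-≤ : ∀ t → ∃ λ p → p ≤ t × (p ≡ 0 ⊎ O p) × (∀ q → p < q → q ≤ t → ¬ O q)
  latest-≤ zero = 0 , z≤n , inj₁ refl , λ { _ () z≤n }
  latest-≤ (suc t) with O? (suc t)
  ... | yes o = suc t , ≤-refl , inj₂ o , λ q 1+t<q q≤1+t → ⊥-elim (<⇒≱ 1+t<q q≤1+t)
  ... | no ¬o =
    let p , p≤t , anchor , none = latest-≤ t
    in p , m≤n⇒m≤1+n p≤t , anchor , none′ none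
    where
    none′ : ∀ {p} → (∀ q → p < q → q ≤ t → ¬ O q) → ∀ q → p < q → q ≤ suc t → ¬ O q
    none′ none q p<q q≤1+t with m≤n⇒m<n∨m≡n q≤1+t
    ... | inj₁ q<1+t = none q p<q (s≤s⁻¹ q<1+t)
    ... | inj₂ refl  = ¬o

squeeze-2 : ∀ {p t q} → p ≤ t → suc t < q → q ≤ p + 2 → p ≡ t × q ≡ 2 + t
squeeze-2 {p} {t} {q} p≤t 1+t<q q≤p+2 = p≡t , ≤-antisym (subst (λ x → q ≤ 2 + x) p≡t q≤2+p) 1+t<q
  where
  q≤2+p : q ≤ 2 + p
  q≤2+p = subst (q ≤_) (+-comm p 2) q≤p+2
  p≡t : p ≡ t
  p≡t = ≤-antisym p≤t (s≤s⁻¹ (s≤s⁻¹ (≤-trans 1+t<q q≤2+p)))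

squeeze-3 : ∀ {p t q} → p ≤ t → suc t < q → q ≤ p + 3 → p ≡ t ⊎ q ≡ 2 + t
squeeze-3 {p} {t} {q} p≤t 1+t<q q≤p+3 with m≤n⇒m<n∨m≡n 1+t<q
... | inj₂ 2+t≡q = inj₂ (sym 2+t≡q)
... | inj₁ 2+t<q = inj₁ (≤-antisym p≤t (s≤s⁻¹ (s≤s⁻¹ (s≤s⁻¹ (≤-trans 2+t<q q≤3+p)))))
  where
  q≤3+p : q ≤ 3 + p
  q≤3+p = subst (q ≤_) (+-comm p 3) q≤p+3

module _ {D : List ℕ} {k : ℕ} (S : Schedule D k) where
  open Schedule S

  Anchor : Fin (length D) → ℕ → Set
  Anchor i p = p ≡ 0 ⊎ OccAt seq i p

  anchor-visit : ∀ {i p} → 1 ≤ p → Anchor i p → OccAt seq i p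
  anchor-visit ()  (inj₁ refl)
  anchor-visit _   (inj₂ occ) = occ

  visits-after : ∀ i {t} → t < k → ∃ λ q → t < q × OccAt seq i q
  visits-after i {t} t<k = occurs-after seq i (subst (t <_) (sym (count i)) t<k)

  straddle : ∀ i {t} → t < k → ¬ OccAt seq i (suc t) →
    ∃₂ λ p q → p ≤ t × suc t < q × q ≤ p + lookup D i × Anchor i p × OccAt seq i q
  straddle i {t} t<k free =
    let p , p≤t , anchor , none = latest-≤ (OccAt? seq i) t
        q₀ , t<q₀ , occ₀ = visits-after i t<k
        q , p<q , q≤p+d , occ = gaps i p anchor (q₀ , ≤-<-trans p≤t t<q₀ , occ₀)
    in p , q , p≤t , beyond p<q occ none , q≤p+d , anchor , occ
    where
    beyond : ∀ {p q} → p < q → OccAt seq i q → (∀ q → p < q → q ≤ t → ¬ OccAt seq i q) → suc t < q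
    beyond {q = q} p<q occ none with <-cmp q (suc t)
    ... | tri< q<1+t _ _ = ⊥-elim (none q p<q (s≤s⁻¹ q<1+t) occ)
    ... | tri≈ _ refl _  = ⊥-elim (free occ)
    ... | tri> _ _ 1+t<q = 1+t<q

  around-2 : ∀ {i t} → lookup D i ≤ 2 → 1 ≤ t → t < k → ¬ OccAt seq i (suc t) →
    OccAt seq i t × OccAt seq i (2 + t)
  around-2 {i} di≤2 1≤t t<k free with straddle i t<k free
  ... | p , q , p≤t , 1+t<q , q≤p+d , anchor , occ
    with squeeze-2 p≤t 1+t<q (≤-trans q≤p+d (+-monoʳ-≤ p di≤2))
  ...   | refl , refl = anchor-visit 1≤t anchor , occ

  around-3 : ∀ {i t} → lookup D i ≤ 3 → 1 ≤ t → t < k → ¬ OccAt seq i (suc t) →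
    OccAt seq i t ⊎ OccAt seq i (2 + t)
  around-3 {i} di≤3 1≤t t<k free with straddle i t<k free
  ... | p , q , p≤t , 1+t<q , q≤p+d , anchor , occ
    with squeeze-3 p≤t 1+t<q (≤-trans q≤p+d (+-monoʳ-≤ p di≤3))
  ...   | inj₁ refl = inj₁ (anchor-visit 1≤t anchor)
  ...   | inj₂ refl = inj₂ occ

  -- Positions are 1-based, so suc t ranges over [2, k].
  crowded-out : ∀ {a b j t} → a ≢ b → lookup D a ≤ 2 → lookup D b ≤ 3 → j ≢ a → j ≢ b →
    1 ≤ t → t < k → ¬ OccAt seq j (suc t)
  crowded-out {a} {b} a≢b da≤2 db≤3 j≢a j≢b 1≤t t<k occ
    with around-2 da≤2 1≤t t<k (λ occa → j≢a (OccAt-unique seq occ occa))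
       | around-3 db≤3 1≤t t<k (λ occb → j≢b (OccAt-unique seq occ occb))
  ... | a-at-t , _ | inj₁ b-at-t = a≢b (OccAt-unique seq a-at-t b-at-t)
  ... | _ , a-at-2+t | inj₂ b-at-2+t = a≢b (OccAt-unique seq a-at-2+t b-at-2+t)

  visit-in-[2,k] : ∀ i → lookup D i < k → 1 < k → ∃ λ t → 1 ≤ t × t < k × OccAt seq i (suc t)
  visit-in-[2,k] i di<k 1<k with gaps i 0 (inj₁ refl) (visits-after i (<-trans (s≤s z≤n) 1<k))
  ... | zero , () , _
  ... | suc (suc t) , _ , q≤di , occ = suc t , s≤s z≤n , <-trans q≤di di<k , occ
  ... | suc zero , _ , _ , occ₁ with gaps i 1 (inj₂ occ₁) (visits-after i 1<k)
  ...   | zero , () , _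
  ...   | suc zero , s≤s () , _
  ...   | suc (suc t) , _ , q≤1+di , occ = suc t , s≤s z≤n , ≤-<-trans (s≤s⁻¹ q≤1+di) di<k , occ

no-schedule-2-3 : ∀ {d k} → d < k → 1 < k → ¬ Schedule (2 ∷ 3 ∷ d ∷ []) k
no-schedule-2-3 d<k 1<k S =
  let t , 1≤t , t<k , occ = visit-in-[2,k] S (fsuc (fsuc fzero)) d<k 1<k
  in crowded-out S {a = fzero} {b = fsuc fzero} (λ ()) ≤-refl ≤-refl (λ ()) (λ ()) 1≤t t<k occ

theorem12 : (k : ℕ) → 7 ≤ k → (δ : ℚ) → bound k <ℚ δ →
    ∃ λ (D : List ℕ) → All (1 ≤_) D × density D ≤ℚ δ × ¬ Schedule D k
theorem12 k 7≤k δ bound<δ =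
  2 ∷ 3 ∷ m ∷ [] , s≤s z≤n ∷ s≤s z≤n ∷ 1≤m ∷ [] , density≤δ , no-schedule-2-3 m<k 1<k
  where
  m : ℕ
  m = (k ∸ 1) / 6
  1≤m : 1 ≤ m
  1≤m = m≥n⇒m/n>0 (∸-monoˡ-≤ 1 7≤k)
  1<k : 1 < k
  1<k = ≤-trans (s≤s (s≤s z≤n)) 7≤k
  m<k : m < k
  m<k = ≤-<-trans (m/n≤m (k ∸ 1) 6) (∸-monoʳ-< (s≤s z≤n) (<-trans (s≤s z≤n) 1<k))
  density≡bound : density (2 ∷ 3 ∷ m ∷ []) ≡ bound k
  density≡bound = trans (sym (ℚ.+-assoc (inv 2) (inv 3) (inv m ℚ.+ ℚ.0ℚ)))
                        (cong (inv 2 ℚ.+ inv 3 ℚ.+_) (ℚ.+-identityʳ (inv m)))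
  density≤δ : density (2 ∷ 3 ∷ m ∷ []) ≤ℚ δ
  density≤δ = ℚ.<⇒≤ (subst (_<ℚ δ) (sym density≡bound) bound<δ)
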